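{- Let $r \geq 1$ be an integer and let $b > 1$ be an integer with $\gcd(2,b) = 1$ such that $2^r b^2$ is almost perfect. Then $$\frac{\sigma(2^r)}{b} < 1 < \frac{\sigma(b)}{b} < \frac{4}{3} < \frac{3}{2} \leq \frac{\sigma(2^r)}{2^r} < 2 < \frac{\sigma(b)}{2^r}.$$
   Context: $\sigma(x)$ denotes the sum of the positive divisors of $x$. A positive integer $y$ is almost perfect if $\sigma(y) = 2y - 1$. -}

module Defs where

open import Data.Nat using (ℕ; suc; _+_; _*_; _∸_)
open import Data.Nat.Divisibility using (_∣?_)
open import Data.List using (List; filter; upTo; map)
open import Data.Nat.ListAction using (sum)

σ : ℕ → ℕ
σ n = sum (filter (_∣? n) (map suc (upTo n)))

open import Relation.Binary.PropositionalEquality using (_≡_)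
open import Data.Product using (_×_)
open import Data.Nat using (_≥_)

AlmostPerfect : ℕ → Set
AlmostPerfect y = (y ≥ 1) × (σ y ≡ 2 * y ∸ 1)

module Submission where

-- Let n = 2^r·b² be almost perfect, with r ≥ 1 and b > 1 odd, and write P = 2^r,
-- S = σ(P), s = σ(b), T = σ(b²).  Since P and b² are coprime, σ is super-multiplicative
-- on them, so S·T ≤ σ(n) = 2n − 1 < 2P·b².  Elementary divisor counting gives
-- s ≥ b + 1, T ≥ b·s + 1 > b² and S ≥ 2P − 1; the first inequality then forces
-- S = 2P − 1 and, rewritten as S·(T − b²) < b², yields both S < b and T < 4b²/3,
-- whence s < 4b/3.  The stated chain of fractions follows by cross-multiplication.

open import Defs
open import Data.Nat using (ℕ; _^_; _*_; _≤_; _<_; NonZero; s≤s; z≤n)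
open import Data.Nat.GCD using (gcd)
open import Data.Integer using (+_)
open import Data.Rational using (ℚ; _/_; 1ℚ) renaming (_<_ to _<ℚ_; _≤_ to _≤ℚ_)
open import Data.Product using (_×_)
open import Relation.Binary.PropositionalEquality using (_≡_)

module SumsOverDistinctLists where

  open import Data.Nat using (ℕ; _+_; _*_; _≤_; z≤n)
  open import Data.Nat.Properties
  open import Data.Nat.ListAction using (sum)
  open import Data.Nat.ListAction.Properties using (sum-++)
  open import Data.List using (List; []; _∷_; _++_; filter; map; cartesianProduct)
  open import Data.List.Properties using (filter-all; filter-accept; filter-reject; map-++; map-∘)
  import Data.List.Relation.Unary.All as All
  import Data.List.Relation.Unary.All.Properties as All
  open import Data.List.Relation.Unary.AllPairs using ([]; _∷_)
  open import Data.List.Relation.Unary.Unique.Propositional using (Unique)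
  import Data.List.Relation.Unary.Unique.Propositional.Properties as Unique
  open import Data.List.Relation.Unary.Any using (here; there)
  open import Data.List.Membership.Propositional using (_∈_)
  open import Data.List.Membership.Propositional.Properties using (∈-filter⁻)
  open import Data.List.Relation.Binary.Subset.Propositional using (_⊆_)
  open import Data.Product using (_,_; uncurry)
  open import Algebra.Properties.CommutativeSemigroup +-commutativeSemigroup using (x∙yz≈y∙xz)
  open import Relation.Nullary using (yes; no; ¬?)
  open import Relation.Binary.PropositionalEquality
  open import Data.Empty using (⊥-elim)

  without : ℕ → List ℕ → List ℕ
  without y = filter (λ x → ¬? (x ≟ y))

  sum-without : ∀ y (xs : List ℕ) → Unique xs → sum xs ≤ y + sum (without y xs)
  sum-without y [] _ = z≤n
  sum-without y (x ∷ xs) (x∉xs ∷ xs!) with x ≟ y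
  ... | yes refl = ≤-reflexive (cong (λ zs → x + sum zs) (sym without-xs))
    where
      without-xs : without x (x ∷ xs) ≡ xs
      without-xs = trans (filter-reject (λ z → ¬? (z ≟ x)) (λ x≢x → x≢x refl))
                         (filter-all (λ z → ¬? (z ≟ x)) (All.map (λ x≢z z≡x → x≢z (sym z≡x)) x∉xs))
  ... | no x≢y = begin
      x + sum xs                        ≤⟨ +-monoʳ-≤ x (sum-without y xs xs!) ⟩
      x + (y + sum (without y xs))      ≡⟨ x∙yz≈y∙xz x y _ ⟩
      y + (x + sum (without y xs))      ≡⟨ cong (λ zs → y + sum zs) (sym (filter-accept (λ z → ¬? (z ≟ y)) x≢y)) ⟩
      y + sum (without y (x ∷ xs))      ∎
    where open ≤-Reasoning

  sum-mono-⊆ : ∀ (ys xs : List ℕ) → Unique xs → xs ⊆ ys → sum xs ≤ sum ys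
  sum-mono-⊆ [] [] _ _ = z≤n
  sum-mono-⊆ [] (x ∷ xs) _ xs⊆[] with () ← xs⊆[] (here refl)
  sum-mono-⊆ (y ∷ ys) xs xs! xs⊆y∷ys =
    ≤-trans (sum-without y xs xs!)
            (+-monoʳ-≤ y (sum-mono-⊆ ys (without y xs) (Unique.filter⁺ _ xs!) rest⊆ys))
    where
      rest⊆ys : without y xs ⊆ ys
      rest⊆ys x∈rest with ∈-filter⁻ (λ z → ¬? (z ≟ y)) x∈rest
      ... | x∈xs , x≢y with xs⊆y∷ys x∈xs
      ...   | here x≡y  = ⊥-elim (x≢y x≡y)
      ...   | there x∈ys = x∈ys

  map-injectiveOn⁺ : ∀ {A B : Set} (f : A → B) {xs : List A} →
                     (∀ {x y} → x ∈ xs → y ∈ xs → f x ≡ f y → x ≡ y) →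
                     Unique xs → Unique (map f xs)
  map-injectiveOn⁺ f inj [] = []
  map-injectiveOn⁺ f inj (x∉xs ∷ xs!) =
    All.map⁺ (All.tabulate λ y∈xs fx≡fy → All.lookup x∉xs y∈xs (inj (here refl) (there y∈xs) fx≡fy))
    ∷ map-injectiveOn⁺ f (λ x∈ y∈ → inj (there x∈) (there y∈)) xs!

  products : List ℕ → List ℕ → List ℕ
  products xs ys = map (uncurry _*_) (cartesianProduct xs ys)

  sum-map-* : ∀ c (xs : List ℕ) → sum (map (c *_) xs) ≡ c * sum xs
  sum-map-* c [] = sym (*-zeroʳ c)
  sum-map-* c (x ∷ xs) = trans (cong (λ t → c * x + t) (sum-map-* c xs)) (sym (*-distribˡ-+ c x (sum xs)))

  sum-products : ∀ xs ys → sum (products xs ys) ≡ sum xs * sum ys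
  sum-products [] ys = refl
  sum-products (x ∷ xs) ys = begin
      sum (map (uncurry _*_) (map (x ,_) ys ++ cartesianProduct xs ys))
        ≡⟨ cong sum (map-++ (uncurry _*_) (map (x ,_) ys) (cartesianProduct xs ys)) ⟩
      sum (map (uncurry _*_) (map (x ,_) ys) ++ products xs ys)
        ≡⟨ sum-++ (map (uncurry _*_) (map (x ,_) ys)) (products xs ys) ⟩
      sum (map (uncurry _*_) (map (x ,_) ys)) + sum (products xs ys)
        ≡⟨ cong₂ _+_ (trans (cong sum (sym (map-∘ ys))) (sum-map-* x ys)) (sum-products xs ys) ⟩
      x * sum ys + sum xs * sum ys
        ≡⟨ sym (*-distribʳ-+ (sum ys) x (sum xs)) ⟩
      (x + sum xs) * sum ys ∎
    where open ≡-Reasoning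

module Coprimality where

  open import Data.Nat using (zero; suc; _*_; _^_)
  open import Data.Nat.Divisibility using (_∣_; ∣-trans; ∣-refl; ∣1⇒≡1)
  open import Data.Nat.Coprimality as Coprime using (Coprime; coprime-divisor)
  open import Data.Product using (_,_)

  coprime-divisors : ∀ {a c w z} → Coprime a c → w ∣ a → z ∣ c → Coprime w z
  coprime-divisors a⊥c w∣a z∣c (i∣w , i∣z) = a⊥c (∣-trans i∣w w∣a , ∣-trans i∣z z∣c)

  coprime-*ʳ : ∀ {m n o} → Coprime m n → Coprime m o → Coprime m (n * o)
  coprime-*ʳ m⊥n m⊥o (i∣m , i∣no) =
    m⊥o (i∣m , coprime-divisor (coprime-divisors m⊥n i∣m ∣-refl) i∣no)

  coprime-^ˡ : ∀ {m c} r → Coprime m c → Coprime (m ^ r) c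
  coprime-^ˡ zero    _   (i∣1 , _) = ∣1⇒≡1 i∣1
  coprime-^ˡ (suc r) m⊥c = Coprime.sym (coprime-*ʳ (Coprime.sym m⊥c) (Coprime.sym (coprime-^ˡ r m⊥c)))

module DivisorSums where

  open SumsOverDistinctLists
  open Coprimality using (coprime-divisors)
  open import Data.Nat using (ℕ; zero; suc; _+_; _*_; _^_; _≤_; _<_; z≤n; s≤s; NonZero; >-nonZero)
  open import Data.Nat.Properties
  open import Data.Nat.Divisibility
  open import Data.Nat.Coprimality using (Coprime; coprime-divisor)
  open import Data.Nat.ListAction using (sum)
  open import Data.List using (List; _∷_; filter; map; upTo; cartesianProduct)
  import Data.List.Relation.Unary.All as All
  open import Data.List.Relation.Unary.AllPairs using (_∷_)
  open import Data.List.Relation.Unary.Unique.Propositional using (Unique)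
  import Data.List.Relation.Unary.Unique.Propositional.Properties as Unique
  open import Data.List.Relation.Unary.Any using (here; there)
  open import Data.List.Membership.Propositional using (_∈_)
  open import Data.List.Membership.Propositional.Properties
    using (∈-filter⁺; ∈-filter⁻; ∈-map⁺; ∈-map⁻; ∈-upTo⁺; ∈-cartesianProduct⁻)
  open import Data.List.Relation.Binary.Subset.Propositional using (_⊆_)
  open import Data.Product using (_×_; _,_; proj₁; proj₂)
  open import Relation.Binary.PropositionalEquality

  divisors : ℕ → List ℕ
  divisors n = filter (_∣? n) (map suc (upTo n))

  divisors-unique : ∀ n → Unique (divisors n)
  divisors-unique n = Unique.filter⁺ (_∣? n) (Unique.map⁺ suc-injective (Unique.upTo⁺ n))

  ∈-divisors⁺ : ∀ {d n} → 0 < n → d ∣ n → d ∈ divisors n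
  ∈-divisors⁺ {zero} 0<n 0∣n with () ← <-irrefl (sym (0∣⇒≡0 0∣n)) 0<n
  ∈-divisors⁺ {suc d} {n} 0<n d∣n =
    ∈-filter⁺ (_∣? n) (∈-map⁺ suc (∈-upTo⁺ (∣⇒≤ {{>-nonZero 0<n}} d∣n))) d∣n

  ∈-divisors⁻ : ∀ {d} n → d ∈ divisors n → d ∣ n × 0 < d
  ∈-divisors⁻ n d∈ with ∈-filter⁻ (_∣? n) {xs = map suc (upTo n)} d∈
  ... | d∈suc[upTo] , d∣n with ∈-map⁻ suc d∈suc[upTo]
  ...   | _ , _ , refl = d∣n , s≤s z≤n

  coprime-factorisation-unique : ∀ {a c w x y z} → Coprime a c →
    w ∣ a → x ∣ a → y ∣ c → z ∣ c → 0 < w → w * y ≡ x * z → w ≡ x × y ≡ z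
  coprime-factorisation-unique {w = w} {x} {y} {z} a⊥c w∣a x∣a y∣c z∣c 0<w wy≡xz =
    w≡x , *-cancelˡ-≡ y z w {{>-nonZero 0<w}} (trans wy≡xz (cong (_* z) (sym w≡x)))
    where
      w∣x : w ∣ x
      w∣x = coprime-divisor (coprime-divisors a⊥c w∣a z∣c)
              (subst (w ∣_) (trans wy≡xz (*-comm x z)) (m∣m*n y))
      x∣w : x ∣ w
      x∣w = coprime-divisor (coprime-divisors a⊥c x∣a y∣c)
              (subst (x ∣_) (trans (sym wy≡xz) (*-comm w y)) (m∣m*n z))
      w≡x : w ≡ x
      w≡x = ∣-antisym w∣x x∣w

  -- σ is super-multiplicative on coprime arguments (in fact multiplicative; this half suffices).
  σ-supermultiplicative : ∀ a c → 0 < a → 0 < c → Coprime a c → σ a * σ c ≤ σ (a * c)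
  σ-supermultiplicative a c 0<a 0<c a⊥c = begin
      σ a * σ c                                ≡⟨ sum-products (divisors a) (divisors c) ⟨
      sum (products (divisors a) (divisors c)) ≤⟨ sum-mono-⊆ (divisors (a * c)) _ products-unique products⊆ ⟩
      σ (a * c)                                ∎
    where
      open ≤-Reasoning
      pairs : List (ℕ × ℕ)
      pairs = cartesianProduct (divisors a) (divisors c)
      product-injective : ∀ {p q} → p ∈ pairs → q ∈ pairs → proj₁ p * proj₂ p ≡ proj₁ q * proj₂ q → p ≡ q
      product-injective {w , y} {x , z} p∈ q∈ wy≡xz
        with w∈ , y∈ ← ∈-cartesianProduct⁻ (divisors a) (divisors c) p∈
           | x∈ , z∈ ← ∈-cartesianProduct⁻ (divisors a) (divisors c) q∈
        with w≡x , y≡z ← coprime-factorisation-unique a⊥c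
               (proj₁ (∈-divisors⁻ a w∈)) (proj₁ (∈-divisors⁻ a x∈))
               (proj₁ (∈-divisors⁻ c y∈)) (proj₁ (∈-divisors⁻ c z∈))
               (proj₂ (∈-divisors⁻ a w∈)) wy≡xz
        = cong₂ _,_ w≡x y≡z
      products-unique : Unique (products (divisors a) (divisors c))
      products-unique = map-injectiveOn⁺ _ product-injective
        (Unique.cartesianProduct⁺ (divisors-unique a) (divisors-unique c))
      products⊆ : products (divisors a) (divisors c) ⊆ divisors (a * c)
      products⊆ v∈ with (w , y) , p∈ , refl ← ∈-map⁻ _ v∈
                   with w∈ , y∈ ← ∈-cartesianProduct⁻ (divisors a) (divisors c) p∈ =
        ∈-divisors⁺ (*-mono-< 0<a 0<c) (*-pres-∣ (proj₁ (∈-divisors⁻ a w∈)) (proj₁ (∈-divisors⁻ c y∈)))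

  -- For c ≥ 2, the divisors of c·k include 1 and c·d for each divisor d of k, all distinct.
  σ-scale : ∀ c k → 2 ≤ c → 0 < k → 1 + c * σ k ≤ σ (c * k)
  σ-scale c k 2≤c 0<k = begin
      1 + c * σ k                               ≡⟨ cong suc (sum-map-* c (divisors k)) ⟨
      sum (1 ∷ map (c *_) (divisors k))         ≤⟨ sum-mono-⊆ (divisors (c * k)) _ scaled-unique scaled⊆ ⟩
      σ (c * k)                                 ∎
    where
      open ≤-Reasoning
      instance c≢0 : NonZero c
      c≢0 = >-nonZero (≤-trans (s≤s z≤n) 2≤c)
      1∉scaled : ∀ {v} → v ∈ map (c *_) (divisors k) → 1 ≢ v
      1∉scaled v∈ 1≡v with d , d∈ , refl ← ∈-map⁻ (c *_) v∈ =
        <-irrefl 1≡v (≤-trans 2≤c (m≤m*n c d {{>-nonZero (proj₂ (∈-divisors⁻ k d∈))}}))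
      scaled-unique : Unique (1 ∷ map (c *_) (divisors k))
      scaled-unique = All.tabulate 1∉scaled ∷ Unique.map⁺ (*-cancelˡ-≡ _ _ c) (divisors-unique k)
      0<ck : 0 < c * k
      0<ck = ≤-trans 0<k (m≤n*m k c)
      scaled⊆ : 1 ∷ map (c *_) (divisors k) ⊆ divisors (c * k)
      scaled⊆ (here refl) = ∈-divisors⁺ 0<ck (1∣ _)
      scaled⊆ (there v∈) with d , d∈ , refl ← ∈-map⁻ (c *_) v∈ =
        ∈-divisors⁺ 0<ck (*-monoʳ-∣ c (proj₁ (∈-divisors⁻ k d∈)))

  -- σ(n) ≥ n + 1 for n ≥ 2 (the divisors 1 and n).
  σ-lower : ∀ {n} → 2 ≤ n → 1 + n ≤ σ n
  σ-lower {n} 2≤n =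
    subst₂ (λ m k → 1 + m ≤ σ k) (*-identityʳ n) (*-identityʳ n) (σ-scale n 1 2≤n (s≤s z≤n))

  -- σ(2^i) ≥ 2^(i+1) − 1 (in fact equality holds; the lower bound suffices).
  σ-pow2 : ∀ i → 2 * 2 ^ i ≤ 1 + σ (2 ^ i)
  σ-pow2 zero = ≤-refl
  σ-pow2 (suc i) = begin
      2 * (2 * 2 ^ i)       ≤⟨ *-monoʳ-≤ 2 (σ-pow2 i) ⟩
      2 * (1 + σ (2 ^ i))   ≡⟨ *-distribˡ-+ 2 1 (σ (2 ^ i)) ⟩
      2 + 2 * σ (2 ^ i)     ≤⟨ +-monoʳ-≤ 1 (σ-scale 2 (2 ^ i) ≤-refl (m^n>0 2 i)) ⟩
      1 + σ (2 * 2 ^ i)     ∎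
    where open ≤-Reasoning

  almostPerfect⇒deficient : ∀ n → AlmostPerfect n → σ n < 2 * n
  almostPerfect⇒deficient zero (() , _)
  almostPerfect⇒deficient (suc k) (_ , σn≡2n-1) = subst (_< 2 * suc k) (sym σn≡2n-1) (n<1+n _)

module AlmostPerfectArithmetic where

  open import Data.Nat using (suc; _+_; _*_; _∸_; _≤_; _<_)
  open import Data.Nat.Properties
  open import Algebra.Properties.CommutativeSemigroup *-commutativeSemigroup using (x∙yz≈y∙xz)
  open import Relation.Binary.PropositionalEquality
  open ≤-Reasoning

  <-multiplier : ∀ {S T Q B} → B ≤ T → S * T < Q * B → S < Q
  <-multiplier {S} {T} {Q} B≤T ST<QB = *-cancelʳ-< T S Q (<-≤-trans ST<QB (*-monoʳ-≤ Q B≤T))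

  excess-bound : ∀ {S T B} → B ≤ T → S * T < (1 + S) * B → S * (T ∸ B) < B
  excess-bound {S} {T} {B} B≤T ST<[1+S]B = +-cancelˡ-< (S * B) (S * (T ∸ B)) B (begin-strict
      S * B + S * (T ∸ B)   ≡⟨ *-distribˡ-+ S B (T ∸ B) ⟨
      S * (B + (T ∸ B))     ≡⟨ cong (S *_) (m+[n∸m]≡n B≤T) ⟩
      S * T                 <⟨ ST<[1+S]B ⟩
      B + S * B             ≡⟨ +-comm B (S * B) ⟩
      S * B + B             ∎)

  square-excess : ∀ {b s T} → 1 + b ≤ s → 1 + b * s ≤ T → (1 + b) + b * b ≤ T
  square-excess {b} {s} {T} b<s bs<T = begin
      (1 + b) + b * b   ≡⟨ cong suc (*-suc b b) ⟨
      1 + b * (1 + b)   ≤⟨ +-monoʳ-≤ 1 (*-monoʳ-≤ b b<s) ⟩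
      1 + b * s         ≤⟨ bs<T ⟩
      T                 ∎

  small-factor : ∀ {S U b} → 1 + b ≤ U → S * U < b * b → S < b
  small-factor {S} {U} {b} b<U SU<bb = *-cancelʳ-< (1 + b) S b (begin-strict
      S * (1 + b)   ≤⟨ *-monoʳ-≤ S b<U ⟩
      S * U         <⟨ SU<bb ⟩
      b * b         ≤⟨ *-monoʳ-≤ b (n≤1+n b) ⟩
      b * (1 + b)   ∎)

  small-ratio : ∀ {S T B} → 3 ≤ S → B ≤ T → S * (T ∸ B) < B → 3 * T < 4 * B
  small-ratio {S} {T} {B} 3≤S B≤T excess = begin-strict
      3 * T                   ≡⟨ cong (3 *_) (m+[n∸m]≡n B≤T) ⟨
      3 * (B + (T ∸ B))       ≡⟨ *-distribˡ-+ 3 B (T ∸ B) ⟩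
      3 * B + 3 * (T ∸ B)     <⟨ +-monoʳ-< (3 * B) (≤-<-trans (*-monoˡ-≤ (T ∸ B) 3≤S) excess) ⟩
      3 * B + B               ≡⟨ +-comm (3 * B) B ⟩
      4 * B                   ∎

  abundancy-bound : ∀ {b s T} → 1 + b * s ≤ T → 3 * T < 4 * (b * b) → 3 * s < 4 * b
  abundancy-bound {b} {s} {T} bs<T 3T<4bb = *-cancelˡ-< b (3 * s) (4 * b) (begin-strict
      b * (3 * s)     ≡⟨ x∙yz≈y∙xz b 3 s ⟩
      3 * (b * s)     <⟨ *-monoʳ-< 3 (n<1+n (b * s)) ⟩
      3 * (1 + b * s) ≤⟨ *-monoʳ-≤ 3 bs<T ⟩
      3 * T           <⟨ 3T<4bb ⟩
      4 * (b * b)     ≡⟨ x∙yz≈y∙xz 4 b b ⟩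
      b * (4 * b)     ∎)

  three-halves : ∀ {P S} → 2 ≤ P → 1 + S ≡ 2 * P → 3 * P ≤ 2 * S
  three-halves {P} {S} 2≤P 1+S≡2P = +-cancelˡ-≤ 2 (3 * P) (2 * S) (begin
      2 + 3 * P       ≤⟨ +-monoˡ-≤ (3 * P) 2≤P ⟩
      4 * P           ≡⟨ *-assoc 2 2 P ⟩
      2 * (2 * P)     ≡⟨ cong (2 *_) 1+S≡2P ⟨
      2 * (1 + S)     ≡⟨ *-distribˡ-+ 2 1 S ⟩
      2 + 2 * S       ∎)

module AlmostPerfectBounds where

  open DivisorSums
  open Coprimality using (coprime-*ʳ; coprime-^ˡ)
  open AlmostPerfectArithmetic
  open import Data.Nat using (_+_; _*_; _∸_; _^_; _≤_; _<_)
  open import Data.Nat.Properties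
  open import Data.Nat.Coprimality using (Coprime)
  open import Data.Product using (_×_; _,_)
  open import Relation.Binary.PropositionalEquality

  almostPerfect-bounds : ∀ r b → 1 ≤ r → 1 < b → Coprime 2 b → AlmostPerfect (2 ^ r * (b * b)) →
    let P = 2 ^ r ; S = σ (2 ^ r) ; s = σ b in
    (S < b) × (b < s) × (3 * s < 4 * b) × (3 * P ≤ 2 * S) × (S < 2 * P) × (2 * P < s)
  almostPerfect-bounds r b 1≤r 1<b 2⊥b n-almostPerfect =
    S<b , b<s , 3s<4b , three-halves 2≤P 1+S≡2P , S<2P , subst (_< s) 1+S≡2P (≤-<-trans S<b b<s)
    where
      P B S s T : ℕ
      P = 2 ^ r ; B = b * b ; S = σ P ; s = σ b ; T = σ B
      0<b : 0 < b
      0<b = <-trans (n<1+n 0) 1<b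
      2≤P : 2 ≤ P
      2≤P = ^-monoʳ-≤ 2 1≤r
      deficient : S * T < 2 * P * B
      deficient = begin-strict
        S * T         ≤⟨ σ-supermultiplicative P B (m^n>0 2 r) (*-mono-< 0<b 0<b) (coprime-^ˡ r (coprime-*ʳ 2⊥b 2⊥b)) ⟩
        σ (P * B)     <⟨ almostPerfect⇒deficient (P * B) n-almostPerfect ⟩
        2 * (P * B)   ≡⟨ *-assoc 2 P B ⟨
        2 * P * B     ∎
        where open ≤-Reasoning
      b<s : b < s
      b<s = σ-lower 1<b
      T-large : 1 + b * s ≤ T
      T-large = σ-scale b b 1<b 0<b
      B+b<T : (1 + b) + B ≤ T
      B+b<T = square-excess b<s T-large
      B≤T : B ≤ T
      B≤T = m+n≤o⇒n≤o (1 + b) B+b<T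
      S<2P : S < 2 * P
      S<2P = <-multiplier B≤T deficient
      1+S≡2P : 1 + S ≡ 2 * P
      1+S≡2P = ≤-antisym S<2P (σ-pow2 r)
      excess : S * (T ∸ B) < B
      excess = excess-bound {S} B≤T (subst (λ Q → S * T < Q * B) (sym 1+S≡2P) deficient)
      S<b : S < b
      S<b = small-factor (m+n≤o⇒m≤o∸n (1 + b) B+b<T) excess
      3≤S : 3 ≤ S
      3≤S = +-cancelˡ-≤ 1 3 S (subst (4 ≤_) (sym 1+S≡2P) (*-monoʳ-≤ 2 2≤P))
      3s<4b : 3 * s < 4 * b
      3s<4b = abundancy-bound {b} {s} T-large (small-ratio {S} 3≤S B≤T excess)

module FractionComparison where

  open import Data.Nat as ℕ using (suc; NonZero)
  open import Data.Integer as ℤ using (+_; +<+; +≤+)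
  import Data.Integer.Properties as ℤ
  open import Data.Rational.Properties using (toℚᵘ-cancel-<; toℚᵘ-cancel-≤; toℚᵘ-fromℚᵘ)
  open import Data.Rational.Unnormalised using (mkℚᵘ; *<*; *≤*)
  import Data.Rational.Unnormalised.Properties as ℚᵘ
  open import Relation.Binary.PropositionalEquality using (subst₂)

  /-< : ∀ a b c d .{{_ : NonZero b}} .{{_ : NonZero d}} → a ℕ.* d ℕ.< c ℕ.* b → (+ a) / b <ℚ (+ c) / d
  /-< a (suc b) c (suc d) ad<cb = toℚᵘ-cancel-<
    (ℚᵘ.<-respˡ-≃ (ℚᵘ.≃-sym (toℚᵘ-fromℚᵘ (mkℚᵘ (+ a) b)))
      (ℚᵘ.<-respʳ-≃ (ℚᵘ.≃-sym (toℚᵘ-fromℚᵘ (mkℚᵘ (+ c) d)))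
        (*<* (subst₂ ℤ._<_ (ℤ.pos-* a (suc d)) (ℤ.pos-* c (suc b)) (+<+ ad<cb)))))

  /-≤ : ∀ a b c d .{{_ : NonZero b}} .{{_ : NonZero d}} → a ℕ.* d ℕ.≤ c ℕ.* b → (+ a) / b ≤ℚ (+ c) / d
  /-≤ a (suc b) c (suc d) ad≤cb = toℚᵘ-cancel-≤
    (ℚᵘ.≤-respˡ-≃ (ℚᵘ.≃-sym (toℚᵘ-fromℚᵘ (mkℚᵘ (+ a) b)))
      (ℚᵘ.≤-respʳ-≃ (ℚᵘ.≃-sym (toℚᵘ-fromℚᵘ (mkℚᵘ (+ c) d)))
        (*≤* (subst₂ ℤ._≤_ (ℤ.pos-* a (suc d)) (ℤ.pos-* c (suc b)) (+≤+ ad≤cb)))))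

open AlmostPerfectBounds using (almostPerfect-bounds)
open FractionComparison using (/-<; /-≤)
open import Data.Nat.Properties using (*-comm; *-identityˡ; *-identityʳ; ≤-refl)
open import Data.Nat.Coprimality using (gcd≡1⇒coprime)
open import Data.Product using (_,_)
open import Relation.Binary.PropositionalEquality using (refl; sym; subst₂)

theorem4 : (r b : ℕ) → 1 ≤ r → 1 < b → gcd 2 b ≡ 1 → AlmostPerfect (2 ^ r * (b * b))
    → .{{_ : NonZero b}} → .{{_ : NonZero (2 ^ r)}}
    → ((+ σ (2 ^ r)) / b <ℚ 1ℚ)
    × (1ℚ <ℚ (+ σ b) / b)
    × ((+ σ b) / b <ℚ (+ 4) / 3)
    × ((+ 4) / 3 <ℚ (+ 3) / 2)
    × ((+ 3) / 2 ≤ℚ (+ σ (2 ^ r)) / (2 ^ r))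
    × ((+ σ (2 ^ r)) / (2 ^ r) <ℚ (+ 2) / 1)
    × ((+ 2) / 1 <ℚ (+ σ b) / (2 ^ r))
theorem4 r b 1≤r 1<b gcd[2,b]≡1 n-almostPerfect
  with S<b , b<s , 3s<4b , 3P≤2S , S<2P , 2P<s
         ← almostPerfect-bounds r b 1≤r 1<b (gcd≡1⇒coprime gcd[2,b]≡1) n-almostPerfect
  = /-< S b 1 1 (subst₂ _<_ (sym (*-identityʳ S)) (sym (*-identityˡ b)) S<b)
  , /-< 1 1 s b (subst₂ _<_ (sym (*-identityˡ b)) (sym (*-identityʳ s)) b<s)
  , /-< s b 4 3 (subst₂ _<_ (*-comm 3 s) refl 3s<4b)
  , /-< 4 3 3 2 ≤-refl
  , /-≤ 3 2 S P (subst₂ _≤_ refl (*-comm 2 S) 3P≤2S)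
  , /-< S P 2 1 (subst₂ _<_ (sym (*-identityʳ S)) refl S<2P)
  , /-< 2 1 s P (subst₂ _<_ refl (sym (*-identityʳ s)) 2P<s)
  where
    P S s : ℕ
    P = 2 ^ r ; S = σ P ; s = σ b
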